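{- Let $\mathcal{A}$ be a finite alphabet and let $s$ be a balanced standard episturmian sequence over $\mathcal{A}$ containing at least three distinct letters, with directive sequence $\Delta=\Delta_1\Delta_2\cdots$. Let $j$ be the smallest index such that $\Delta_j=\Delta_i$ for some $i<j$, and suppose that this first repeated letter $\Delta_j$ is different from the first letter $\Delta_1$. Then $\Delta_1,\dots,\Delta_{j-1}$ are pairwise distinct and $\Delta_m=\Delta_{j-1}$ for all $m\ge j-1$; that is, up to renaming the letters, $\Delta=1\,2\cdots(k-1)\,k^{\omega}$.
   Context: For a finite word $w$, $w^{(+)}$ denotes the shortest palindrome having $w$ as a prefix. For an infinite word $\Delta=x_1x_2\cdots$ set $u_1=\varepsilon$, $u_{n+1}=(u_nx_n)^{(+)}$. An infinite word $s$ is standard episturmian if there exists an infinite word $\Delta$ (a directive sequence of $s$) such that every $u_n$ is a prefix of $s$. A word is balanced if for any two factors $u,v$ of the same length and every letter $a$, $||u|_a-|v|_a|\le1$, where $|u|_a$ counts occurrences of $a$ in $u$. -}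

module Defs where

open import Data.Nat using (ℕ; zero; suc; _+_; _≤_; _<_; ∣_-_∣)
open import Data.Fin using (Fin)
open import Data.Fin.Properties using (_≟_)
open import Data.List using (List; []; _∷_; _++_; length; reverse; map; upTo; filter; [_])
open import Data.Product using (Σ; ∃; _×_; _,_)
open import Relation.Binary.PropositionalEquality using (_≡_; _≢_)

module _ {n : ℕ} where

  Word : Set
  Word = List (Fin n)

  InfWord : Set
  InfWord = ℕ → Fin n

  IsPrefix : Word → Word → Set
  IsPrefix w p = ∃ λ t → w ++ t ≡ p

  IsPalindrome : Word → Set
  IsPalindrome p = reverse p ≡ p

  IsPalClosure : Word → Word → Set
  IsPalClosure w p =
    IsPalindrome p × IsPrefix w p ×
    (∀ q → IsPalindrome q → IsPrefix w q → length p ≤ length q)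

  prefixOf : InfWord → ℕ → Word
  prefixOf s ℓ = map s (upTo ℓ)

  IsPrefixInf : Word → InfWord → Set
  IsPrefixInf w s = prefixOf s (length w) ≡ w

  factor : InfWord → ℕ → ℕ → Word
  factor s i ℓ = map (λ k → s (i + k)) (upTo ℓ)

  occ : Fin n → Word → ℕ
  occ a w = length (filter (a ≟_) w)

  -- Δ (0-indexed: Δ 0 = Δ_1) is a directive sequence of s:
  -- u_1 = ε, u_{n+1} = (u_n x_n)^(+), all u_n prefixes of s.
  -- Here u k corresponds to u_{k+1}.
  IsDirective : InfWord → InfWord → Set
  IsDirective s Δ =
    ∃ λ (u : ℕ → Word) →
      (u 0 ≡ []) ×
      (∀ k → IsPalClosure (u k ++ [ Δ k ]) (u (suc k))) ×
      (∀ k → IsPrefixInf (u k) s)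

  IsStandardEpisturmian : InfWord → Set
  IsStandardEpisturmian s = ∃ λ Δ → IsDirective s Δ

  Balanced : InfWord → Set
  Balanced s = ∀ i j ℓ (a : Fin n) → ∣ occ a (factor s i ℓ) - occ a (factor s j ℓ) ∣ ≤ 1

  AtLeastThreeLetters : InfWord → Set
  AtLeastThreeLetters s =
    ∃ λ p → ∃ λ q → ∃ λ r → (s p ≢ s q) × (s p ≢ s r) × (s q ≢ s r)

-- Write ℓ m for the length of u m, so that s (ℓ m) = Δ m. Being the shortest palindrome extending
-- u m · Δ m, u (m+1) has length between ℓ m + 1 and 2 ℓ m + 1, and it is u m · Δ m · u m when Δ m is
-- a new letter. Balance forbids a factor of length L + 2 avoiding a letter b when b also occurs twice
-- at distance L + 1. A repetition Δ (k+1) = Δ i with 0 < i < k produces such a pair of occurrences of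
-- Δ i, opposed to the factor Δ 0 · Δ k · u i around position ℓ k. For Δ = a b b … the pair is b a b,
-- opposed to the factor a c a around the first occurrence of a third letter c. If Δ (k+1) = Δ k = c
-- with k ≥ 2, the prefixes are (w c)^r w with w = u k while c is repeated; after a different letter d
-- the palindromic closure mirrors d to a position p whose next ℓ k + 1 letters avoid c, which
-- contradicts the periodicity of (w c)^r w, or forces Δ 0 = Δ 1, or is opposed by balance to the
-- factor c w c.

module Submission where

open import Defs
open import Data.Empty using (⊥; ⊥-elim)
open import Data.Fin using (Fin)
open import Data.Fin.Properties using () renaming (_≟_ to _≟ᶠ_)
open import Data.List using ([]; _∷_; _++_; [_]; length; reverse; filter; applyUpTo; applyDownFrom)
open import Data.List.Properties
  using ( ∷-injectiveˡ; ∷-injectiveʳ; ++-assoc; applyUpTo-∷ʳ; length-applyUpTo; map-upTo; reverse-applyUpTo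
        ; filter-accept; filter-none; filter-some)
import Data.List.Relation.Unary.All.Properties as All
import Data.List.Relation.Unary.Any.Properties as Any
open import Data.Nat using (ℕ; zero; suc; _+_; _∸_; _⊓_; _≤_; _<_; _≤?_; z≤n; s≤s; z<s; s<s; s≤s⁻¹; ∣_-_∣)
open import Data.Nat.Induction using (<-wellFounded)
open import Data.Nat.Properties
open import Data.Nat.Tactic.RingSolver using (solve-∀)
open import Data.Product using (∃; _×_; _,_; proj₁; proj₂; map₂; swap)
open import Data.Sum using (inj₁; inj₂)
open import Function using (_∘_)
open import Induction.WellFounded using (Acc; acc)
open import Relation.Binary.Definitions using (DecidableEquality; tri<; tri≈; tri>)
open import Relation.Binary.PropositionalEquality
  using (_≡_; _≢_; refl; sym; trans; cong; cong₂; subst; module ≡-Reasoning)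
open import Relation.Nullary using (yes; no)

module _ {a} {A : Set a} where

  PalindromicPrefix : (ℕ → A) → ℕ → Set a
  PalindromicPrefix f L = ∀ x y → suc (x + y) ≡ L → f x ≡ f y

  applyUpTo-++ : ∀ (f : ℕ → A) m n → applyUpTo f (m + n) ≡ applyUpTo f m ++ applyUpTo (f ∘ (m +_)) n
  applyUpTo-++ f zero    n = refl
  applyUpTo-++ f (suc m) n = cong (f 0 ∷_) (applyUpTo-++ (f ∘ suc) m n)

  applyUpTo-cong : ∀ {f g : ℕ → A} n → (∀ {i} → i < n → f i ≡ g i) → applyUpTo f n ≡ applyUpTo g n
  applyUpTo-cong zero    f≗g = refl
  applyUpTo-cong {f} {g} (suc n) f≗g =
    cong₂ _∷_ (f≗g z<s) (applyUpTo-cong {f ∘ suc} {g ∘ suc} n (λ {i} i<n → f≗g {suc i} (s<s i<n)))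

  applyUpTo-injective : ∀ {f g : ℕ → A} n → applyUpTo f n ≡ applyUpTo g n → ∀ {i} → i < n → f i ≡ g i
  applyUpTo-injective (suc n) eq {zero}  _         = ∷-injectiveˡ eq
  applyUpTo-injective {f} {g} (suc n) eq {suc i} (s<s i<n) =
    applyUpTo-injective {f ∘ suc} {g ∘ suc} n (∷-injectiveʳ eq) i<n

  applyDownFrom-mirror : ∀ (f : ℕ → A) n → applyDownFrom f n ≡ applyUpTo (λ i → f (n ∸ suc i)) n
  applyDownFrom-mirror f zero    = refl
  applyDownFrom-mirror f (suc n) = cong (f n ∷_) (applyDownFrom-mirror f n)

  reverse-applyUpTo-mirror : ∀ (f : ℕ → A) n → reverse (applyUpTo f n) ≡ applyUpTo (λ i → f (n ∸ suc i)) n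
  reverse-applyUpTo-mirror f n = trans (reverse-applyUpTo f n) (applyDownFrom-mirror f n)

  palindrome⇒palindromicPrefix : ∀ (f : ℕ → A) n → reverse (applyUpTo f n) ≡ applyUpTo f n → PalindromicPrefix f n
  palindrome⇒palindromicPrefix f n pal x y refl = begin
    f x              ≡⟨ cong f (sym (m+n∸n≡m x y)) ⟩
    f (x + y ∸ y)    ≡⟨ applyUpTo-injective {λ i → f (n ∸ suc i)} {f} n mirrored (s≤s (m≤n+m y x)) ⟩
    f y              ∎
    where
    open ≡-Reasoning
    mirrored : applyUpTo (λ i → f (n ∸ suc i)) n ≡ applyUpTo f n
    mirrored = trans (sym (reverse-applyUpTo-mirror f n)) pal

  palindromicPrefix⇒palindrome : ∀ (f : ℕ → A) n → PalindromicPrefix f n → reverse (applyUpTo f n) ≡ applyUpTo f n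
  palindromicPrefix⇒palindrome f n pal = trans (reverse-applyUpTo-mirror f n) (applyUpTo-cong n mirror)
    where
    mirror : ∀ {i} → i < n → f (n ∸ suc i) ≡ f i
    mirror {i} i<n = pal (n ∸ suc i) i (trans (sym (+-suc (n ∸ suc i) i)) (m∸n+n≡m i<n))

  applyUpTo-++-∷ : ∀ (f : ℕ → A) xs {x ys} n → xs ++ x ∷ ys ≡ applyUpTo f n → length xs < n × x ≡ f (length xs)
  applyUpTo-++-∷ f []       (suc n) eq = z<s , ∷-injectiveˡ eq
  applyUpTo-++-∷ f (_ ∷ xs) (suc n) eq with applyUpTo-++-∷ (f ∘ suc) xs n (∷-injectiveʳ eq)
  ... | lt , x≡ = s<s lt , x≡

module _ {a} {A : Set a} (f : ℕ → A) where

  FirstOccurrence : ℕ → Set a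
  FirstOccurrence m = ∀ i → i < m → f i ≢ f m

  first-occurrence : DecidableEquality A → ∀ m → ∃ λ m′ → f m′ ≡ f m × FirstOccurrence m′
  first-occurrence _≟_ m = go m (<-wellFounded m)
    where
    go : ∀ m → Acc _<_ m → ∃ λ m′ → f m′ ≡ f m × FirstOccurrence m′
    go m (acc earlier) with anyUpTo? (λ i → f i ≟ f m) m
    ... | no none = m , refl , λ i i<m fi≡fm → none (i , i<m , fi≡fm)
    ... | yes (i , i<m , fi≡fm) with go i (earlier i<m)
    ...   | m′ , fm′≡fi , first = m′ , trans fm′≡fi fi≡fm , first

module _ {n : ℕ} {s : InfWord {n}} where

  avoid-one-of : ∀ {x} y {t t′} → s t ≢ s t′ → s t ≢ x → s t′ ≢ x → ∃ λ t″ → s t″ ≢ x × s t″ ≢ y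
  avoid-one-of y {t} {t′} t≢t′ t≢x t′≢x with s t ≟ᶠ y
  ... | no t≢y   = t , t≢x , t≢y
  ... | yes refl = t′ , t′≢x , t≢t′ ∘ sym

  three-letters-avoid : AtLeastThreeLetters s → ∀ a b → ∃ λ t → s t ≢ a × s t ≢ b
  three-letters-avoid (p , q , r , p≢q , p≢r , q≢r) a b with s p ≟ᶠ a | s p ≟ᶠ b
  ... | no p≢a   | no p≢b   = p , p≢a , p≢b
  ... | yes refl | _        = avoid-one-of b q≢r (p≢q ∘ sym) (p≢r ∘ sym)
  ... | no _     | yes refl = map₂ swap (avoid-one-of a q≢r (p≢q ∘ sym) (p≢r ∘ sym))

  occ-factor-≡0 : ∀ {b} i L → (∀ t → t < L → s (i + t) ≢ b) → occ b (factor s i L) ≡ 0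
  occ-factor-≡0 {b} i L avoids =
    trans (cong (length ∘ filter (b ≟ᶠ_)) (map-upTo _ L)) (cong length (filter-none (b ≟ᶠ_) none))
    where none = All.applyUpTo⁺₁ (λ t → s (i + t)) L (λ t<L b≡ → avoids _ t<L (sym b≡))

  occ-factor-≥2 : ∀ {b} j L → s j ≡ b → s (j + suc L) ≡ b → 2 ≤ occ b (factor s j (suc (suc L)))
  occ-factor-≥2 {b} j L first last = begin
    2                                                            ≤⟨ s≤s (filter-some (b ≟ᶠ_) last-occurs) ⟩
    suc (length (filter (b ≟ᶠ_) (applyUpTo (window ∘ suc) L+1)))
      ≡⟨ cong length (filter-accept (b ≟ᶠ_) b≡first) ⟨
    length (filter (b ≟ᶠ_) (applyUpTo window (suc L+1)))
      ≡⟨ cong (length ∘ filter (b ≟ᶠ_)) (map-upTo window (suc L+1)) ⟨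
    occ b (factor s j (suc L+1))                                 ∎
    where
    open ≤-Reasoning
    L+1 = suc L
    window : ℕ → Fin n
    window t = s (j + t)
    b≡first : b ≡ window 0
    b≡first = trans (sym first) (cong s (sym (+-identityʳ j)))
    last-occurs = Any.applyUpTo⁺ (window ∘ suc) (sym last) (n<1+n L)

  balanced-gap : Balanced s → ∀ {b} i j L → (∀ t → t < suc (suc L) → s (i + t) ≢ b) →
                 s j ≡ b → s (j + suc L) ≡ b → ⊥
  balanced-gap balanced {b} i j L avoids first last = <⇒≱ (occ-factor-≥2 j L first last) (begin
    occ b (factor s j L+2)                              ≡⟨ ∣-∣-identityʳ _ ⟨
    ∣ occ b (factor s j L+2) - 0 ∣                      ≡⟨ cong (∣ occ b (factor s j L+2) -_∣) no-b ⟨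
    ∣ occ b (factor s j L+2) - occ b (factor s i L+2) ∣ ≤⟨ balanced j i L+2 b ⟩
    1                                                   ∎)
    where
    open ≤-Reasoning
    L+2 = suc (suc L)
    no-b = occ-factor-≡0 i L+2 avoids

module Directive {n : ℕ} {s Δ : InfWord {n}} (directive : IsDirective s Δ) where

  u : ℕ → Word
  u = proj₁ directive

  private
    u-zero : u 0 ≡ []
    u-zero = proj₁ (proj₂ directive)

    closure : ∀ m → IsPalClosure (u m ++ [ Δ m ]) (u (suc m))
    closure = proj₁ (proj₂ (proj₂ directive))

    u-prefix : ∀ m → IsPrefixInf (u m) s
    u-prefix = proj₂ (proj₂ (proj₂ directive))

  ℓ : ℕ → ℕ
  ℓ m = length (u m)

  u≡applyUpTo : ∀ m → u m ≡ applyUpTo s (ℓ m)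
  u≡applyUpTo m = trans (sym (u-prefix m)) (map-upTo s (ℓ m))

  ℓ-zero : ℓ 0 ≡ 0
  ℓ-zero = cong length u-zero

  palindromic : ∀ m → PalindromicPrefix s (ℓ m)
  palindromic m = palindrome⇒palindromicPrefix s (ℓ m) (subst (λ w → reverse w ≡ w) (u≡applyUpTo m) (u-palindrome m))
    where
    u-palindrome : ∀ m → IsPalindrome (u m)
    u-palindrome zero    = subst IsPalindrome (sym u-zero) refl
    u-palindrome (suc m) = proj₁ (closure m)

  private
    ℓ-<×s-ℓ : ∀ m → ℓ m < ℓ (suc m) × Δ m ≡ s (ℓ m)
    ℓ-<×s-ℓ m with proj₁ (proj₂ (closure m))
    ... | t , extends = applyUpTo-++-∷ s (u m) (ℓ (suc m))
                          (trans (sym (++-assoc (u m) [ Δ m ] t)) (trans extends (u≡applyUpTo (suc m))))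

  ℓ-< : ∀ m → ℓ m < ℓ (suc m)
  ℓ-< m = proj₁ (ℓ-<×s-ℓ m)

  s-ℓ : ∀ m → s (ℓ m) ≡ Δ m
  s-ℓ m = sym (proj₂ (ℓ-<×s-ℓ m))

  ℓ-suc-minimal : ∀ m (g : InfWord) L → ℓ m < L → (∀ {i} → i ≤ ℓ m → g i ≡ s i) →
                  PalindromicPrefix g L → ℓ (suc m) ≤ L
  ℓ-suc-minimal m g L ℓm<L agrees pal with m≤n⇒∃[o]m+o≡n ℓm<L
  ... | b , refl = subst (ℓ (suc m) ≤_) (length-applyUpTo g L)
                     (proj₂ (proj₂ (closure m)) (applyUpTo g L) (palindromicPrefix⇒palindrome g L pal) (_ , extends))
    where
    open ≡-Reasoning
    rest : Word
    rest = applyUpTo (g ∘ (suc (ℓ m) +_)) b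
    extends : (u m ++ [ Δ m ]) ++ rest ≡ applyUpTo g L
    extends = begin
      (u m ++ [ Δ m ]) ++ rest                    ≡⟨ cong (λ w → (w ++ [ Δ m ]) ++ rest) (u≡applyUpTo m) ⟩
      (applyUpTo s (ℓ m) ++ [ Δ m ]) ++ rest      ≡⟨ cong (λ x → (applyUpTo s (ℓ m) ++ [ x ]) ++ rest) (s-ℓ m) ⟨
      (applyUpTo s (ℓ m) ++ [ s (ℓ m) ]) ++ rest  ≡⟨ cong (_++ rest) (applyUpTo-∷ʳ s (ℓ m)) ⟩
      applyUpTo s (suc (ℓ m)) ++ rest             ≡⟨ cong (_++ rest) (applyUpTo-cong _ (sym ∘ agrees ∘ s≤s⁻¹)) ⟩
      applyUpTo g (suc (ℓ m)) ++ rest             ≡⟨ applyUpTo-++ g (suc (ℓ m)) b ⟨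
      applyUpTo g L                               ∎

  -- The witness s (i ⊓ (N ∸ i)) is a palindrome of length N + 1 that agrees with s up to position ℓ m.
  ℓ-suc-≤ : ∀ m p → (∀ x y → x + y ≡ ℓ m + p → p ≤ x → p ≤ y → s x ≡ s y) →
            ℓ (suc m) ≤ suc (ℓ m + p)
  ℓ-suc-≤ m p symmetric = ℓ-suc-minimal m folded (suc N) (s≤s (m≤m+n (ℓ m) p)) agrees folded-palindromic
    where
    N = ℓ m + p
    folded : InfWord
    folded i = s (i ⊓ (N ∸ i))
    folded-palindromic : PalindromicPrefix folded (suc N)
    folded-palindromic x y 1+x+y≡1+N = begin
      s (x ⊓ (N ∸ x))         ≡⟨ cong (λ z → s (x ⊓ (z ∸ x))) x+y≡N ⟨
      s (x ⊓ (x + y ∸ x))     ≡⟨ cong (λ z → s (x ⊓ z)) (m+n∸m≡n x y) ⟩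
      s (x ⊓ y)               ≡⟨ cong s (⊓-comm x y) ⟩
      s (y ⊓ x)               ≡⟨ cong (λ z → s (y ⊓ z)) (m+n∸n≡m x y) ⟨
      s (y ⊓ (x + y ∸ y))     ≡⟨ cong (λ z → s (y ⊓ (z ∸ y))) x+y≡N ⟩
      s (y ⊓ (N ∸ y))         ∎
      where
      open ≡-Reasoning
      x+y≡N = suc-injective 1+x+y≡1+N
    agrees : ∀ {i} → i ≤ ℓ m → folded i ≡ s i
    agrees {i} i≤ℓm with i ≤? N ∸ i
    ... | yes i≤N∸i = cong s (m≤n⇒m⊓n≡m i≤N∸i)
    ... | no  i≰N∸i = trans (cong s (m≥n⇒m⊓n≡n (<⇒≤ N∸i<i)))
                        (symmetric (N ∸ i) i (m∸n+n≡m i≤N) p≤N∸i (≤-trans p≤N∸i (<⇒≤ N∸i<i)))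
      where
      N∸i<i = ≰⇒> i≰N∸i
      i≤N = ≤-trans i≤ℓm (m≤m+n (ℓ m) p)
      p≤N∸i : p ≤ N ∸ i
      p≤N∸i = subst (_≤ N ∸ i) (m+n∸m≡n (ℓ m) p) (∸-monoʳ-≤ N i≤ℓm)

  ℓ-suc-≤-double : ∀ m → ℓ (suc m) ≤ suc (ℓ m + ℓ m)
  ℓ-suc-≤-double m = ℓ-suc-≤ m (ℓ m) λ x y x+y≡ ℓm≤x ℓm≤y →
    cong s (trans (squeeze x+y≡ ℓm≤x ℓm≤y) (sym (squeeze (trans (+-comm y x) x+y≡) ℓm≤y ℓm≤x)))
    where
    squeeze : ∀ {x y a} → x + y ≡ a + a → a ≤ x → a ≤ y → x ≡ a
    squeeze {x} {_} {a} x+y≡a+a a≤x a≤y =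
      ≤-antisym (+-cancelʳ-≤ a x a (subst (x + a ≤_) x+y≡a+a (+-monoʳ-≤ x a≤y))) a≤x

  ℓ-suc-mirror : ∀ m → ∃ λ p → ℓ (suc m) ≡ suc (ℓ m + p) × s p ≡ Δ m
  ℓ-suc-mirror m with m≤n⇒∃[o]m+o≡n (ℓ-< m)
  ... | p , 1+ℓm+p≡ =
    p , sym 1+ℓm+p≡ , trans (palindromic (suc m) p (ℓ m) (trans (cong suc (+-comm p (ℓ m))) 1+ℓm+p≡)) (s-ℓ m)

  ℓ-suc-≥ : ∀ m V → (∀ t → t < V → s t ≢ Δ m) → suc (ℓ m + V) ≤ ℓ (suc m)
  ℓ-suc-≥ m V absent with ℓ-suc-mirror m
  ... | p , ℓ≡ , sp≡Δm =
    subst (suc (ℓ m + V) ≤_) (sym ℓ≡) (s≤s (+-monoʳ-≤ (ℓ m) (≮⇒≥ λ p<V → absent p p<V sp≡Δm)))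

  ℓ-mirror : ∀ m t → ℓ m < t → t < ℓ (suc m) → ∃ λ y → y < ℓ m × s t ≡ s y
  ℓ-mirror m t ℓm<t t<ℓ with m≤n⇒∃[o]m+o≡n t<ℓ
  ... | y , 1+t+y≡ = y , +-cancelˡ-< (ℓ m) y (ℓ m) (begin-strict
        ℓ m + y      <⟨ +-monoˡ-< y ℓm<t ⟩
        t + y        ≤⟨ s≤s⁻¹ (subst (_≤ suc (ℓ m + ℓ m)) (sym 1+t+y≡) (ℓ-suc-≤-double m)) ⟩
        ℓ m + ℓ m    ∎) , palindromic (suc m) t y 1+t+y≡
    where open ≤-Reasoning

  letters : ∀ m t → t < ℓ m → ∃ λ j → j < m × s t ≡ Δ j
  letters zero    t t<ℓ0 = ⊥-elim (n≮0 (subst (t <_) ℓ-zero t<ℓ0))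
  letters (suc m) t t<ℓ with <-cmp t (ℓ m)
  ... | tri< t<ℓm _ _ with letters m t t<ℓm
  ...   | j , j<m , st≡Δj = j , m<n⇒m<1+n j<m , st≡Δj
  letters (suc m) t t<ℓ | tri≈ _ refl _ = m , n<1+n m , s-ℓ m
  letters (suc m) t t<ℓ | tri> _ _ ℓm<t with ℓ-mirror m t ℓm<t t<ℓ
  ... | y , y<ℓm , st≡sy with letters m y y<ℓm
  ...   | j , j<m , sy≡Δj = j , m<n⇒m<1+n j<m , trans st≡sy sy≡Δj

  first-occurrence-absent : ∀ {m} → FirstOccurrence Δ m → ∀ t → t < ℓ m → s t ≢ Δ m
  first-occurrence-absent {m} first t t<ℓm st≡Δm with letters m t t<ℓm
  ... | j , j<m , st≡Δj = first j j<m (trans (sym st≡Δj) st≡Δm)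

  ℓ-first-occurrence : ∀ {m} → FirstOccurrence Δ m → ℓ (suc m) ≡ suc (ℓ m + ℓ m)
  ℓ-first-occurrence {m} first = ≤-antisym (ℓ-suc-≤-double m) (ℓ-suc-≥ m (ℓ m) (first-occurrence-absent first))

  border-period : ∀ m P q → ℓ (suc m) ≡ P + ℓ m → q < ℓ m → s (P + q) ≡ s q
  border-period m P q ℓ≡ q<ℓm with m≤n⇒∃[o]m+o≡n q<ℓm
  ... | y , 1+q+y≡ℓm = trans (palindromic (suc m) (P + q) y mirror) (sym (palindromic m q y 1+q+y≡ℓm))
    where
    mirror : suc (P + q + y) ≡ ℓ (suc m)
    mirror = trans (trans (cong suc (+-assoc P q y)) (sym (+-suc P (q + y)))) (trans (cong (P +_) 1+q+y≡ℓm) (sym ℓ≡))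

  ℓ-mono-< : ∀ {i j} → i < j → ℓ i < ℓ j
  ℓ-mono-< {i} {suc j} (s≤s i≤j) with m≤n⇒m<n∨m≡n i≤j
  ... | inj₁ i<j  = <-trans (ℓ-mono-< i<j) (ℓ-< j)
  ... | inj₂ refl = ℓ-< i

  n≤ℓ : ∀ m → m ≤ ℓ m
  n≤ℓ zero    = z≤n
  n≤ℓ (suc m) = ≤-trans (s≤s (n≤ℓ m)) (ℓ-< m)

  s-zero : s 0 ≡ Δ 0
  s-zero = subst (λ i → s i ≡ Δ 0) ℓ-zero (s-ℓ 0)

  ℓ-one : ℓ 1 ≡ 1
  ℓ-one = trans (ℓ-first-occurrence (λ _ ())) (cong (λ x → suc (x + x)) ℓ-zero)

  s-one : s 1 ≡ Δ 1
  s-one = subst (λ i → s i ≡ Δ 1) ℓ-one (s-ℓ 1)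

  -- Since u (suc m) = u m · Δ m · u m, from position ℓ m ∸ 1 on s reads s 0, Δ m, s 0, s 1, …
  first-occurrence-window-avoids : ∀ {m w V b} → FirstOccurrence Δ m → ℓ m ≡ suc w → 0 < V → V ≤ ℓ m →
                                   Δ m ≢ b → (∀ t → t < V → s t ≢ b) →
                                   ∀ t → t < suc (suc V) → s (w + t) ≢ b
  first-occurrence-window-avoids {m} {w} {V} {b} first ℓ≡ 0<V V≤ℓ Δm≢b avoids = window
    where
    window : ∀ t → t < suc (suc V) → s (w + t) ≢ b
    window zero          _                = avoids 0 0<V ∘ trans (sym (palindromic m (w + 0) 0 mirror))
      where
      mirror : suc (w + 0 + 0) ≡ ℓ m
      mirror = trans (cong suc (trans (+-identityʳ (w + 0)) (+-identityʳ w))) (sym ℓ≡)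
    window (suc zero)    _                = Δm≢b ∘ trans (sym (trans (cong s (trans (+-comm w 1) (sym ℓ≡))) (s-ℓ m)))
    window (suc (suc t)) (s≤s (s≤s t<V)) =
      avoids t t<V ∘ trans (sym (trans (cong s shift) copy))
      where
      shift : w + suc (suc t) ≡ suc (ℓ m) + t
      shift = trans (trans (+-suc w (suc t)) (cong suc (+-suc w t))) (cong (λ x → suc x + t) (sym ℓ≡))
      copy : s (suc (ℓ m) + t) ≡ s t
      copy = border-period m (suc (ℓ m)) t (ℓ-first-occurrence first) (<-≤-trans t<V V≤ℓ)

module BalancedDirective {n : ℕ} {s Δ : InfWord {n}} (directive : IsDirective s Δ) (balanced : Balanced s) where

  open Directive directive

  repeat-gap : ∀ {k} i → FirstOccurrence Δ k → Δ (suc k) ≡ Δ k →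
               (∀ t → t < suc (suc (ℓ k)) → s (i + t) ≢ Δ k) → ⊥
  repeat-gap {k} i first repeat avoids = balanced-gap {s = s} balanced i (ℓ k) (ℓ k) avoids (s-ℓ k) second
    where
    second : s (ℓ k + suc (ℓ k)) ≡ Δ k
    second = trans (cong s (trans (+-suc (ℓ k) (ℓ k)) (sym (ℓ-first-occurrence first)))) (trans (s-ℓ (suc k)) repeat)

  no-earlier-repeat : ∀ {i k} → (∀ j → j ≤ k → FirstOccurrence Δ j) → 0 < i → i < k → Δ (suc k) ≢ Δ i
  no-earlier-repeat {i} {k} first 0<i i<k repeat with m≤n⇒∃[o]m+o≡n (ℓ-mono-< i<k)
  ... | e , 1+V+e≡U = balanced-gap {s = s} balanced (V + e) (U + suc e) V window mirror-of-ℓi at-ℓ1+k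
    where
    U = ℓ k
    V = ℓ i
    window = first-occurrence-window-avoids (first k ≤-refl) (sym 1+V+e≡U) (<-≤-trans 0<i (n≤ℓ i))
               (<⇒≤ (ℓ-mono-< i<k)) (λ Δk≡Δi → first k ≤-refl i i<k (sym Δk≡Δi))
               (first-occurrence-absent (first i (<⇒≤ i<k)))
    mirror-arith : ∀ U e V → U + suc e + V ≡ U + suc (V + e)
    mirror-arith = solve-∀
    end-arith : ∀ U e V → U + suc e + suc V ≡ suc (U + suc (V + e))
    end-arith = solve-∀
    1+U+U : suc (U + suc (V + e)) ≡ ℓ (suc k)
    1+U+U = trans (cong (λ x → suc (U + x)) 1+V+e≡U) (sym (ℓ-first-occurrence (first k ≤-refl)))
    mirror-of-ℓi : s (U + suc e) ≡ Δ i
    mirror-of-ℓi = trans (palindromic (suc k) (U + suc e) V (trans (cong suc (mirror-arith U e V)) 1+U+U)) (s-ℓ i)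
    at-ℓ1+k : s (U + suc e + suc V) ≡ Δ i
    at-ℓ1+k = trans (cong s (trans (end-arith U e V) 1+U+U)) (trans (s-ℓ (suc k)) repeat)

  three-letters⇒¬abb : AtLeastThreeLetters s → Δ 0 ≢ Δ 1 → Δ 2 ≢ Δ 1
  three-letters⇒¬abb three Δ0≢Δ1 repeat with three-letters-avoid three (Δ 0) (Δ 1)
  ... | t , st≢Δ0 , st≢Δ1 with letters (suc t) t (n≤ℓ (suc t))
  ... | j , _ , st≡Δj with first-occurrence Δ _≟ᶠ_ j
  ... | m , Δm≡Δj , first with ℓ m in ℓm≡
  ... | zero  = st≢Δ0 (trans st≡Δj (trans (sym Δm≡Δj) (trans (sym (s-ℓ m)) (trans (cong s ℓm≡) s-zero))))
  ... | suc w =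
    repeat-gap w first-one repeat (subst (λ V → ∀ t → t < suc (suc V) → s (w + t) ≢ Δ 1) (sym ℓ-one) window)
    where
    first-one : FirstOccurrence Δ 1
    first-one zero    _         = Δ0≢Δ1
    first-one (suc _) (s≤s ())
    window = first-occurrence-window-avoids first ℓm≡ z<s (subst (1 ≤_) (sym ℓm≡) (s≤s z≤n))
               (λ Δm≡Δ1 → st≢Δ1 (trans st≡Δj (trans (sym Δm≡Δj) Δm≡Δ1)))
               (λ { zero _ s0≡Δ1 → Δ0≢Δ1 (trans (sym s-zero) s0≡Δ1) ; (suc _) (s≤s ()) })

  module RepeatedFirstOccurrence {k} (first : FirstOccurrence Δ k) (2≤k : 2 ≤ k) (Δ0≢Δ1 : Δ 0 ≢ Δ 1)
                                 (repeat : Δ (suc k) ≡ Δ k) where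

    c : Fin n
    c = Δ k

    U : ℕ
    U = ℓ k

    c-absent : ∀ t → t < U → s t ≢ c
    c-absent = first-occurrence-absent first

    Block : ℕ → Set
    Block r = ∀ j → j ≤ r → Δ (j + k) ≡ c

    block-pred : ∀ {r} → Block (suc r) → Block r
    block-pred block j j≤r = block j (m≤n⇒m≤1+n j≤r)

    block-tail-symmetric : ∀ r → ℓ (suc r + k) ≡ suc U + ℓ (r + k) → Δ (suc r + k) ≡ c →
                           ∀ x y → x + y ≡ ℓ (suc r + k) + U → U ≤ x → U ≤ y → s x ≡ s y
    block-tail-symmetric r N≡ Δ≡c = symmetric
      where
      N = ℓ (suc r + k)
      P = ℓ (r + k)
      ends : s U ≡ s N
      ends = trans (s-ℓ k) (trans (sym Δ≡c) (sym (s-ℓ (suc r + k))))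
      interior : ∀ q y → suc U + q + y ≡ N + U → U < y → s (suc U + q) ≡ s y
      interior q y x+y≡ U<y =
        trans (border-period (r + k) (suc U) q N≡ q<P) (palindromic (suc r + k) q y (trans (cong suc q+y≡) (sym N≡)))
        where
        q+y≡ : q + y ≡ U + P
        q+y≡ = +-cancelˡ-≡ (suc U) (q + y) (U + P) (begin
          suc U + (q + y)    ≡⟨ +-assoc (suc U) q y ⟨
          suc U + q + y      ≡⟨ x+y≡ ⟩
          N + U              ≡⟨ cong (_+ U) N≡ ⟩
          suc U + P + U      ≡⟨ +-assoc (suc U) P U ⟩
          suc U + (P + U)    ≡⟨ cong (suc U +_) (+-comm P U) ⟩
          suc U + (U + P)    ∎)
          where open ≡-Reasoning
        q<P : q < P
        q<P = +-cancelʳ-< U q P (begin-strict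
          q + U   <⟨ +-monoʳ-< q U<y ⟩
          q + y   ≡⟨ trans q+y≡ (+-comm U P) ⟩
          P + U   ∎)
          where open ≤-Reasoning
      symmetric : ∀ x y → x + y ≡ N + U → U ≤ x → U ≤ y → s x ≡ s y
      symmetric x y x+y≡ U≤x U≤y with x ≟ U | y ≟ U
      ... | yes refl | _        = trans ends (cong s (sym (+-cancelˡ-≡ U y N (trans x+y≡ (+-comm N U)))))
      ... | no _     | yes refl = trans (cong s (+-cancelʳ-≡ U x N x+y≡)) (sym ends)
      ... | no x≢U   | no y≢U with m≤n⇒∃[o]m+o≡n (≤∧≢⇒< U≤x (x≢U ∘ sym))
      ...   | q , refl = interior q y x+y≡ (≤∧≢⇒< U≤y (y≢U ∘ sym))

    ℓ-block : ∀ r → Block r → ℓ (suc r + k) ≡ suc U + ℓ (r + k)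
    ℓ-block zero    block = ℓ-first-occurrence first
    ℓ-block (suc r) block = trans (≤-antisym upper lower) (cong suc (+-comm N U))
      where
      N = ℓ (suc r + k)
      Δ≡c : Δ (suc r + k) ≡ c
      Δ≡c = block (suc r) ≤-refl
      upper : ℓ (suc (suc r + k)) ≤ suc (N + U)
      upper = ℓ-suc-≤ (suc r + k) U (block-tail-symmetric r (ℓ-block r (block-pred block)) Δ≡c)
      lower : suc (N + U) ≤ ℓ (suc (suc r + k))
      lower = ℓ-suc-≥ (suc r + k) U (λ t t<U st≡Δ → c-absent t t<U (trans st≡Δ Δ≡c))

    c-at-block-end : ∀ r → Block r → ∀ q → q + U < ℓ (suc r + k) → ℓ (r + k) ≤ q + U →
                     ∃ λ t → t ≤ U × s (q + t) ≡ c
    c-at-block-end r block q q+U<N P≤q+U =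
      t , +-cancelˡ-≤ q t U (subst (_≤ q + U) (sym q+t≡P) P≤q+U)
        , trans (cong s q+t≡P) (trans (s-ℓ (r + k)) (block r ≤-refl))
      where
      q≤P : q ≤ ℓ (r + k)
      q≤P = +-cancelʳ-≤ U q (ℓ (r + k))
              (subst (q + U ≤_) (+-comm U _) (s≤s⁻¹ (subst (q + U <_) (ℓ-block r block) q+U<N)))
      t = proj₁ (m≤n⇒∃[o]m+o≡n q≤P)
      q+t≡P = proj₂ (m≤n⇒∃[o]m+o≡n q≤P)

    c-in-every-window : ∀ r → Block r → ∀ q → q + U < ℓ (suc r + k) → ∃ λ t → t ≤ U × s (q + t) ≡ c
    c-in-every-window zero    block q q+U<N = c-at-block-end zero block q q+U<N (m≤n+m U q)
    c-in-every-window (suc r) block q q+U<N with ℓ (suc r + k) ≤? q + U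
    ... | yes P≤q+U = c-at-block-end (suc r) block q q+U<N P≤q+U
    ... | no  P≰q+U = c-in-every-window r (block-pred block) q (≰⇒> P≰q+U)

    module BlockEnd (r : ℕ) (block : Block r) (Δm≢c : Δ (suc r + k) ≢ c) where

      m = suc r + k
      P = ℓ (r + k)
      N = ℓ m

      N≡ : N ≡ suc (U + P)
      N≡ = ℓ-block r block

      last-copy : ∀ e y → suc (e + y) ≡ U → s (suc P + e) ≡ s y
      last-copy e y 1+e+y≡U = palindromic m (suc P + e) y (begin
        suc (suc P + e + y)    ≡⟨ arith P e y ⟩
        suc (P + suc (e + y))  ≡⟨ cong (λ z → suc (P + z)) 1+e+y≡U ⟩
        suc (P + U)            ≡⟨ cong suc (+-comm P U) ⟩
        suc (U + P)            ≡⟨ N≡ ⟨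
        N                      ∎)
        where
        open ≡-Reasoning
        arith : ∀ P e y → suc (suc P + e + y) ≡ suc (P + suc (e + y))
        arith = solve-∀

      last-avoids : ∀ e → e < U → s (suc P + e) ≢ c
      last-avoids e e<U with m≤n⇒∃[o]m+o≡n e<U
      ... | y , 1+e+y≡U = c-absent y (subst (y <_) 1+e+y≡U (s≤s (m≤n+m y e))) ∘ trans (sym (last-copy e y 1+e+y≡U))

      -- p is the mirror image of the new letter at position N in the palindrome u (suc m).
      p = proj₁ (ℓ-suc-mirror m)

      ℓ-after : ℓ (suc m) ≡ suc (N + p)
      ℓ-after = proj₁ (proj₂ (ℓ-suc-mirror m))

      s-p : s p ≡ Δ m
      s-p = proj₂ (proj₂ (ℓ-suc-mirror m))

      after-avoids : ∀ t → t ≤ U → s (p + t) ≢ c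
      after-avoids zero    _    = Δm≢c ∘ trans (sym (trans (cong s (+-identityʳ p)) s-p))
      after-avoids (suc t) t<U with m≤n⇒∃[o]m+o≡n t<U
      ... | e , 1+t+e≡U = last-avoids e (subst (e <_) 1+t+e≡U (s≤s (m≤n+m e t)))
                          ∘ trans (sym (palindromic (suc m) (p + suc t) (suc P + e) (begin
        suc (p + suc t + (suc P + e))     ≡⟨ arith p t P e ⟩
        suc (suc (suc (t + e) + P) + p)   ≡⟨ cong (λ z → suc (suc (z + P) + p)) 1+t+e≡U ⟩
        suc (suc (U + P) + p)             ≡⟨ cong (λ z → suc (z + p)) N≡ ⟨
        suc (N + p)                       ≡⟨ ℓ-after ⟨
        ℓ (suc m)                         ∎)))
        where
        open ≡-Reasoning
        arith : ∀ p t P e → suc (p + suc t + (suc P + e)) ≡ suc (suc (suc (t + e) + P) + p)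
        arith = solve-∀

      short-mirror-impossible : p + U < N → ⊥
      short-mirror-impossible p+U<N with c-in-every-window r block p p+U<N
      ... | t , t≤U , s≡c = after-avoids t t≤U s≡c

      exact-mirror-impossible : p + U ≡ N → ⊥
      exact-mirror-impossible p+U≡N with m≤n⇒∃[o]m+o≡n (≤-trans 2≤k (n≤ℓ k))
      ... | U′ , 2+U′≡U = Δ0≢Δ1 (begin
        Δ 0                  ≡⟨ s-zero ⟨
        s 0                  ≡⟨ last-copy (suc U′) 0 (trans (cong (suc ∘ suc) (+-identityʳ U′)) 2+U′≡U) ⟨
        s (suc P + suc U′)   ≡⟨ palindromic (suc m) (suc P + 1) (suc P + suc U′) outer ⟨
        s (suc P + 1)        ≡⟨ last-copy 1 U′ 2+U′≡U ⟩
        s U′                 ≡⟨ palindromic k 1 U′ 2+U′≡U ⟨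
        s 1                  ≡⟨ s-one ⟩
        Δ 1                  ∎)
        where
        open ≡-Reasoning
        p≡ : p ≡ suc P
        p≡ = +-cancelʳ-≡ U p (suc P) (trans p+U≡N (trans N≡ (cong suc (+-comm U P))))
        arith : ∀ P U′ → suc (suc P + 1 + (suc P + suc U′)) ≡ suc (suc (suc (suc U′) + P) + suc P)
        arith = solve-∀
        outer : suc (suc P + 1 + (suc P + suc U′)) ≡ ℓ (suc m)
        outer = trans (arith P U′) (trans (cong (λ z → suc (suc (z + P) + suc P)) 2+U′≡U)
                  (trans (cong₂ (λ x y → suc (x + y)) (sym N≡) (sym p≡)) (sym ℓ-after)))

      long-mirror-impossible : N < p + U → ⊥
      long-mirror-impossible N<p+U = repeat-gap (suc P) first repeat window
        where
        1+P<p : suc P < p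
        1+P<p = +-cancelʳ-< U (suc P) p (subst (_< p + U) (trans N≡ (cong suc (+-comm U P))) N<p+U)
        g = proj₁ (m≤n⇒∃[o]m+o≡n 1+P<p)
        2+P+g≡p : suc (suc P + g) ≡ p
        2+P+g≡p = proj₂ (m≤n⇒∃[o]m+o≡n 1+P<p)
        g<U : g < U
        g<U = +-cancelˡ-≤ (suc P) (suc g) U (begin
          suc P + suc g   ≡⟨ +-suc (suc P) g ⟩
          suc (suc P + g) ≡⟨ 2+P+g≡p ⟩
          p               ≤⟨ +-cancelˡ-≤ N p N (s≤s⁻¹ (subst (_≤ suc (N + N)) ℓ-after (ℓ-suc-≤-double m))) ⟩
          N               ≡⟨ trans N≡ (cong suc (+-comm U P)) ⟩
          suc P + U       ∎)
          where open ≤-Reasoning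
        1+P+U≡N : suc P + U ≡ N
        1+P+U≡N = trans (cong suc (+-comm P U)) (sym N≡)
        beyond-N : suc (suc N + (suc P + g)) ≡ ℓ (suc m)
        beyond-N = trans (cong suc (sym (+-suc N (suc P + g)))) (trans (cong (λ z → suc (N + z)) 2+P+g≡p) (sym ℓ-after))
        window : ∀ t → t < suc (suc U) → s (suc P + t) ≢ c
        window t t<U+2 with <-cmp t U
        ... | tri< t<U _ _  = last-avoids t t<U
        ... | tri≈ _ refl _ = Δm≢c ∘ trans (sym (trans (cong s 1+P+U≡N) (s-ℓ m)))
        ... | tri> _ _ U<t with ≤-antisym (s≤s⁻¹ t<U+2) U<t
        ...   | refl = last-avoids g g<U ∘ trans (sym (trans (cong s (trans (+-suc (suc P) U) (cong suc 1+P+U≡N)))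
                                                              (palindromic (suc m) (suc N) (suc P + g) beyond-N)))

      contradiction : ⊥
      contradiction with <-cmp (p + U) N
      ... | tri< p+U<N _ _ = short-mirror-impossible p+U<N
      ... | tri≈ _ p+U≡N _ = exact-mirror-impossible p+U≡N
      ... | tri> _ _ N<p+U = long-mirror-impossible N<p+U

    block-continues : ∀ r → Block r → Δ (suc r + k) ≡ c
    block-continues r block with Δ (suc r + k) ≟ᶠ c
    ... | yes Δ≡c = Δ≡c
    ... | no  Δ≢c = ⊥-elim (BlockEnd.contradiction r block Δ≢c)

    block : ∀ r → Block r
    block zero    zero    _      = refl
    block (suc r) j       j≤1+r with m≤n⇒m<n∨m≡n j≤1+r
    ... | inj₁ j<1+r = block r j (s≤s⁻¹ j<1+r)
    ... | inj₂ refl  = block-continues r (block r)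

    eventually-constant : ∀ m → k ≤ m → Δ m ≡ Δ k
    eventually-constant m k≤m = subst (λ i → Δ i ≡ c) (m∸n+n≡m k≤m) (block (m ∸ k) (m ∸ k) ≤-refl)

  last-repeat-constant : AtLeastThreeLetters s → ∀ {k} → (∀ j → j ≤ suc k → FirstOccurrence Δ j) →
                         Δ (suc (suc k)) ≡ Δ (suc k) → ∀ m → suc k ≤ m → Δ m ≡ Δ (suc k)
  last-repeat-constant three {zero}  first repeat = ⊥-elim (three-letters⇒¬abb three (first 1 ≤-refl 0 z<s) repeat)
  last-repeat-constant _     {suc k} first repeat =
    RepeatedFirstOccurrence.eventually-constant
      (first (suc (suc k)) ≤-refl) (s≤s (s≤s z≤n)) (first 1 (s≤s z≤n) 0 z<s) repeat

  first-repeat-constant : AtLeastThreeLetters s → ∀ {i k} → (∀ j → j ≤ k → FirstOccurrence Δ j) → i ≤ k →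
                          Δ i ≡ Δ (suc k) → Δ (suc k) ≢ Δ 0 → ∀ m → k ≤ m → Δ m ≡ Δ k
  first-repeat-constant three {zero}  first _     Δ0≡Δ1+k Δ1+k≢Δ0 = ⊥-elim (Δ1+k≢Δ0 (sym Δ0≡Δ1+k))
  first-repeat-constant three {suc i} first 1+i≤k Δi≡Δ1+k _ with m≤n⇒m<n∨m≡n 1+i≤k
  ... | inj₁ 1+i<k = ⊥-elim (no-earlier-repeat first z<s 1+i<k (sym Δi≡Δ1+k))
  ... | inj₂ refl  = last-repeat-constant three first (sym Δi≡Δ1+k)

proposition3p5 : (n : ℕ) (s Δ : ℕ → Fin n) →
    IsStandardEpisturmian s → IsDirective s Δ → Balanced s → AtLeastThreeLetters s →
    (k : ℕ) →
    (∃ λ i → i < suc k × Δ i ≡ Δ (suc k)) →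
    (∀ j i → j < suc k → i < j → Δ i ≢ Δ j) →
    Δ (suc k) ≢ Δ 0 →
    (∀ i j → i ≤ k → j ≤ k → i < j → Δ i ≢ Δ j) × (∀ m → k ≤ m → Δ m ≡ Δ k)
proposition3p5 n s Δ _ directive balanced three k (i , s≤s i≤k , Δi≡Δ1+k) distinct Δ1+k≢Δ0 =
  (λ i j _ j≤k → first j j≤k i) , first-repeat-constant three first i≤k Δi≡Δ1+k Δ1+k≢Δ0
  where
  open BalancedDirective directive balanced
  first : ∀ j → j ≤ k → FirstOccurrence Δ j
  first j j≤k i = distinct j i (s≤s j≤k)
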